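{- Let $n$ and $l$ be positive integers. Then $\lfloor \frac{3n}{2}\rfloor$ caffeinated lions suffice to clear the graph $R_{n,l}$, no matter their starting locations: for every initial placement of $\lfloor \frac{3n}{2}\rfloor$ lions on vertices of $R_{n,l}$ there is a sequence of caffeinated moves such that $C(t)=V(R_{n,l})$ at some time $t$.
   Context: For positive integers $n,l$, $R_{n,l}$ is the graph with vertex set $\{(i,j): 1\le i\le l,\ 1\le j\le n\}$ in which $(i,j)$ and $(i',j')$ are adjacent if and only if $(i'-i,j'-j)\in\{(\pm1,0),(0,\pm1),(1,-1),(-1,1)\}$ (a parallelogram-shaped piece of the triangular lattice with $n$ rows of $l$ vertices each). Lions and contamination model: lions occupy vertices of a graph $G=(V,E)$ (several lions may share a vertex). Time is discrete, $t=0,1,2,\dots$. In the caffeinated model, between times $t$ and $t+1$ every lion must move along an edge to an adjacent vertex (no lion may stay in place). $C(t)\subseteq V$ denotes the set of cleared vertices at time $t$. $C(0)$ is the set of vertices occupied by lions at time $0$. For $t\ge0$, a vertex $v$ lies in $C(t+1)$ if and only if either $v$ is occupied by a lion at time $t+1$, or $v\in C(t)$ and for every vertex $u$ adjacent to $v$ with $u\notin C(t)$, some lion moves across the edge from $v$ to $u$ between times $t$ and $t+1$. -}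

module Defs where

open import Data.Nat using (ℕ; zero; suc; _+_; _≡ᵇ_; _<_)
open import Data.Fin using (Fin; toℕ)
open import Data.Bool using (Bool; true; false; _∧_; _∨_; not; T)
open import Data.Product using (_×_; _,_; Σ; ∃)
open import Data.List using (List; allFin; cartesianProduct)
open import Data.Bool.ListAction using (all; any)
open import Relation.Binary.PropositionalEquality using (_≡_)

-- Vertices of R_{n,l}: pairs (i , j) with i ∈ {1..l}, j ∈ {1..n},
-- represented 0-based as Fin l × Fin n.
Vertex : ℕ → ℕ → Set
Vertex n l = Fin l × Fin n

vertices : (n l : ℕ) → List (Vertex n l)
vertices n l = cartesianProduct (allFin l) (allFin n)

adjᵇ : {n l : ℕ} → Vertex n l → Vertex n l → Bool
adjᵇ (i , j) (i' , j') =
     ((toℕ i' ≡ᵇ suc (toℕ i)) ∧ (toℕ j' ≡ᵇ toℕ j))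
   ∨ ((suc (toℕ i') ≡ᵇ toℕ i) ∧ (toℕ j' ≡ᵇ toℕ j))
   ∨ ((toℕ i' ≡ᵇ toℕ i) ∧ (toℕ j' ≡ᵇ suc (toℕ j)))
   ∨ ((toℕ i' ≡ᵇ toℕ i) ∧ (suc (toℕ j') ≡ᵇ toℕ j))
   ∨ ((toℕ i' ≡ᵇ suc (toℕ i)) ∧ (suc (toℕ j') ≡ᵇ toℕ j))
   ∨ ((suc (toℕ i') ≡ᵇ toℕ i) ∧ (toℕ j' ≡ᵇ suc (toℕ j)))

Adj : {n l : ℕ} → Vertex n l → Vertex n l → Set
Adj u v = T (adjᵇ u v)

eqVᵇ : {n l : ℕ} → Vertex n l → Vertex n l → Bool
eqVᵇ (i , j) (i' , j') = (toℕ i ≡ᵇ toℕ i') ∧ (toℕ j ≡ᵇ toℕ j')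

Placement : ℕ → ℕ → ℕ → Set
Placement k n l = Fin k → Vertex n l

Schedule : ℕ → ℕ → ℕ → Set
Schedule k n l = ℕ → Placement k n l

CaffeinatedUpTo : {k n l : ℕ} → Schedule k n l → ℕ → Set
CaffeinatedUpTo {k} σ T = ∀ (s : ℕ) → s < T → (a : Fin k) → Adj (σ s a) (σ (suc s) a)

occupiedᵇ : {k n l : ℕ} → Placement k n l → Vertex n l → Bool
occupiedᵇ {k} p v = any (λ a → eqVᵇ (p a) v) (allFin k)

cleared : {k n l : ℕ} → Schedule k n l → ℕ → Vertex n l → Bool
cleared {k} σ zero v = occupiedᵇ (σ zero) v
cleared {k} {n} {l} σ (suc t) v =
     occupiedᵇ (σ (suc t)) v
   ∨ ( cleared σ t v
     ∧ all (λ u → not (adjᵇ v u ∧ not (cleared σ t u))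
                  ∨ any (λ a → eqVᵇ (σ t a) v ∧ eqVᵇ (σ (suc t) a) u) (allFin k))
           (vertices n l))

AllCleared : {k n l : ℕ} → Schedule k n l → ℕ → Set
AllCleared {k} {n} {l} σ t = ∀ (v : Vertex n l) → cleared σ t v ≡ true

{-# OPTIONS --safe #-}
-- Rank the vertices (i , j) of R_{n,l} column by column, rank = i·n + j.  A cleared
-- vertex stays cleared while every dirty neighbour is entered by a lion, and every
-- neighbour has rank at most n higher; so the cleared region {rank < front} survives
-- a step as soon as the cells from n below the old front up to the new front are
-- occupied, and a lone lion pushing the front along a path only has to cross it.
--
-- If n = 1 or l = 1 the graph is a path: one lion walks to its end and then along it,
-- the others merely keep moving.  Otherwise the rows form ⌊n/2⌋ blocks of two rows
-- (the last of three when n is odd) guarded by three (resp. four) lions, ⌊3n/2⌋ in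
-- all.  The front advances one row every four steps, and a finite table, verified by
-- evaluation, tells each lion of a block where to stand relative to the front so that
-- the band behind the front stays occupied and every lion moves along an edge.
-- Beforehand each lion retraces a walk from the corner to its start and then follows
-- one to its place in the formation; a detour around a triangle fixes the parity, so
-- that all lions arrive simultaneously.

module Submission where

open import Defs
open import Data.Nat using (ℕ; zero; suc; _+_; _∸_; _*_; _≤_; _<_; _≡ᵇ_; _<ᵇ_; _≤ᵇ_; ∣_-_∣; z≤n; s≤s; NonZero; _≟_; _<?_; _≤?_)
open import Data.Nat.Properties
open import Data.Nat.DivMod using (_/_; _%_; m≡m%n+[m/n]*n; m%n<n; m≥n⇒m/n>0; m*n/n≡m; m<n⇒m/n≡0; +-distrib-/-∣ˡ; +-distrib-/-∣ʳ; [m+kn]%n≡m%n; m<n⇒m%n≡m)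
open import Data.Nat.Divisibility using (divides)
open import Data.Nat.Tactic.RingSolver using (solve-∀)
open import Data.Fin using (Fin; toℕ; fromℕ<) renaming (zero to fzero; suc to fsuc; _≟_ to _≟ᶠ_)
open import Data.Fin.Properties using (toℕ<n; toℕ-fromℕ<)
open import Data.Bool using (Bool; true; false; _∧_; _∨_; not; T)
open import Data.Bool.Properties using (T-∧; T-∨; T-≡)
open import Data.Bool.ListAction using (any)
open import Data.Product using (Σ; _×_; _,_; ∃; ∃-syntax; proj₁; proj₂)
open import Data.Product.Properties using (≡-dec)
open import Data.Sum using (_⊎_; inj₁; inj₂)
open import Data.Empty using (⊥-elim)
open import Data.List using (List; []; _∷_; allFin)
open import Data.List.Membership.Propositional using (lose)
open import Data.List.Membership.Propositional.Properties using (∈-allFin)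
open import Data.List.Relation.Unary.All as All using ()
open import Data.List.Relation.Unary.All.Properties using (all⁻)
open import Data.List.Relation.Unary.Any.Properties using (any⁺)
open import Function.Base using (_∘_)
open import Function.Bundles using (Equivalence)
open import Relation.Nullary using (¬_; Dec; yes; no; map′)
open import Relation.Nullary.Decidable using (True; toWitness; T?; _×-dec_; _→-dec_)
open import Relation.Binary.Definitions using (tri<; tri≈; tri>)
open import Relation.Binary.PropositionalEquality using (_≡_; refl; sym; trans; subst; subst₂; cong; cong₂; module ≡-Reasoning)

-- Sweeping

Occupied : {k n l : ℕ} → Placement k n l → Vertex n l → Set
Occupied {k} p v = ∃[ a ] p a ≡ v

Crosses : {k n l : ℕ} → Schedule k n l → ℕ → Vertex n l → Vertex n l → Set
Crosses σ t v u = ∃[ a ] σ t a ≡ v × σ (suc t) a ≡ u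

ClearingSchedule : {k n l : ℕ} → Placement k n l → Set
ClearingSchedule {k} {n} {l} p =
  Σ (Schedule k n l) λ σ → (∀ a → σ 0 a ≡ p a) × ∃ λ t → CaffeinatedUpTo σ t × AllCleared σ t

eqVᵇ-reflexive : {n l : ℕ} {v w : Vertex n l} → v ≡ w → T (eqVᵇ v w)
eqVᵇ-reflexive {v = i , j} refl =
  Equivalence.from (T-∧ {toℕ i ≡ᵇ toℕ i}) (≡⇒≡ᵇ (toℕ i) _ refl , ≡⇒≡ᵇ (toℕ j) _ refl)

occupiedᵇ-complete : {k n l : ℕ} (p : Placement k n l) {v : Vertex n l} →
                     Occupied p v → T (occupiedᵇ p v)
occupiedᵇ-complete p (a , pa≡v) = any⁺ _ (lose (∈-allFin a) (eqVᵇ-reflexive pa≡v))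

cleared-occupied : {k n l : ℕ} (σ : Schedule k n l) (t : ℕ) {v : Vertex n l} →
                   Occupied (σ t) v → T (cleared σ t v)
cleared-occupied σ zero    occ = occupiedᵇ-complete (σ zero) occ
cleared-occupied σ (suc t) occ = Equivalence.from T-∨ (inj₁ (occupiedᵇ-complete (σ (suc t)) occ))

cleared-keep : {k n l : ℕ} (σ : Schedule k n l) (t : ℕ) (v : Vertex n l) →
               T (cleared σ t v) →
               (∀ u → Adj v u → ¬ T (cleared σ t u) → Crosses σ t v u) →
               T (cleared σ (suc t) v)
cleared-keep {k} {n} {l} σ t v v-clear guarded =
  Equivalence.from T-∨ (inj₂ (Equivalence.from T-∧
    (v-clear , all⁻ _ {vertices n l} (All.tabulate λ {u} _ → guard u))))
  where
  guard : ∀ u → T (not (adjᵇ v u ∧ not (cleared σ t u))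
                   ∨ any (λ a → eqVᵇ (σ t a) v ∧ eqVᵇ (σ (suc t) a) u) (allFin k))
  guard u with adjᵇ v u in adj | cleared σ t u in u-clear
  ... | false | _     = _
  ... | true  | true  = _
  ... | true  | false with guarded u (subst T (sym adj) _) (λ c → subst T u-clear c)
  ...   | a , from , to =
    any⁺ _ (lose (∈-allFin a)
      (Equivalence.from (T-∧ {eqVᵇ (σ t a) v}) (eqVᵇ-reflexive from , eqVᵇ-reflexive to)))

module Sweep {k n l : ℕ} (σ : Schedule k n l) (level : Vertex n l → ℕ) (T₀ : ℕ) (L : ℕ → ℕ)
  (start : ∀ v → level v < L 0 → Occupied (σ T₀) v)
  (advance : ∀ τ v → level v < L (suc τ) →
             Occupied (σ (suc (T₀ + τ))) v
             ⊎ (level v < L τ × (∀ u → Adj v u → L τ ≤ level u → Crosses σ (T₀ + τ) v u)))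
  where

  sweep : ∀ τ v → level v < L τ → T (cleared σ (T₀ + τ) v)
  sweep zero v v<L rewrite +-identityʳ T₀ = cleared-occupied σ T₀ (start v v<L)
  sweep (suc τ) v v<L rewrite +-suc T₀ τ with advance τ v v<L
  ... | inj₁ occ = cleared-occupied σ (suc (T₀ + τ)) occ
  ... | inj₂ (v<L′ , crossing) = cleared-keep σ (T₀ + τ) v (sweep τ v v<L′) guarded
    where
    guarded : ∀ u → Adj v u → ¬ T (cleared σ (T₀ + τ) u) → Crosses σ (T₀ + τ) v u
    guarded u adj u-dirty with level u <? L τ
    ... | yes u<L = ⊥-elim (u-dirty (sweep τ u u<L))
    ... | no  u≮L = crossing u adj (≮⇒≥ u≮L)

module BandSweep {k n l : ℕ} (σ : Schedule k n l) (level : Vertex n l → ℕ) (w : ℕ)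
  (reach : ∀ v u → Adj v u → level u ≤ level v + w) (T₀ : ℕ) (L : ℕ → ℕ)
  (start : ∀ v → level v < L 0 → Occupied (σ T₀) v)
  (band : ∀ τ v → level v < L (suc τ) → L τ ≤ level v + w → Occupied (σ (suc (T₀ + τ))) v)
  where

  sweep-band : ∀ τ v → level v < L τ → T (cleared σ (T₀ + τ) v)
  sweep-band = Sweep.sweep σ level T₀ L start advance
    where
    advance : ∀ τ v → level v < L (suc τ) →
              Occupied (σ (suc (T₀ + τ))) v
              ⊎ (level v < L τ × (∀ u → Adj v u → L τ ≤ level u → Crosses σ (T₀ + τ) v u))
    advance τ v v<L with L τ ≤? level v + w
    ... | yes in-band = inj₁ (band τ v v<L in-band)
    ... | no  behind  = inj₂ (≤-<-trans (m≤m+n (level v) w) (≰⇒> behind) , λ u adj L≤u →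
                          ⊥-elim (<⇒≱ (≰⇒> behind) (≤-trans L≤u (reach v u adj))))

-- The triangular lattice

Point : Set
Point = ℕ × ℕ

infix 4 _~_
infixl 6 _⊕_

data _~_ : Point → Point → Set where
  east      : ∀ {x y} → (x , y) ~ (suc x , y)
  west      : ∀ {x y} → (suc x , y) ~ (x , y)
  north     : ∀ {x y} → (x , y) ~ (x , suc y)
  south     : ∀ {x y} → (x , suc y) ~ (x , y)
  southeast : ∀ {x y} → (x , suc y) ~ (suc x , y)
  northwest : ∀ {x y} → (suc x , y) ~ (x , suc y)

~-sym : ∀ {p q} → p ~ q → q ~ p
~-sym east      = west
~-sym west      = east
~-sym north     = south
~-sym south     = north
~-sym southeast = northwest
~-sym northwest = southeast

_⊕_ : Point → Point → Point
(a , b) ⊕ (x , y) = a + x , b + y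

~-translate : ∀ o {p q} → p ~ q → (o ⊕ p) ~ (o ⊕ q)
~-translate (a , b) {x , _} east      rewrite +-suc a x = east
~-translate (a , b) {suc x , _} west  rewrite +-suc a x = west
~-translate (a , b) {_ , y} north     rewrite +-suc b y = north
~-translate (a , b) {_ , suc y} south rewrite +-suc b y = south
~-translate (a , b) {x , suc y} southeast rewrite +-suc a x | +-suc b y = southeast
~-translate (a , b) {suc x , y} northwest rewrite +-suc a x | +-suc b y = northwest

-- adjᵇ on coordinates: Adj v u unfolds to T (adjᵖ (coords v) (coords u)).
adjᵖ : Point → Point → Bool
adjᵖ (x , y) (x' , y') =
     ((x' ≡ᵇ suc x) ∧ (y' ≡ᵇ y))
   ∨ ((suc x' ≡ᵇ x) ∧ (y' ≡ᵇ y))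
   ∨ ((x' ≡ᵇ x) ∧ (y' ≡ᵇ suc y))
   ∨ ((x' ≡ᵇ x) ∧ (suc y' ≡ᵇ y))
   ∨ ((x' ≡ᵇ suc x) ∧ (suc y' ≡ᵇ y))
   ∨ ((suc x' ≡ᵇ x) ∧ (y' ≡ᵇ suc y))

coords : {n l : ℕ} → Vertex n l → Point
coords (i , j) = toℕ i , toℕ j

private
  ≡ᵇ-refl : ∀ m → T (m ≡ᵇ m)
  ≡ᵇ-refl m = ≡⇒≡ᵇ m m refl

  both : ∀ a b c d → T ((a ≡ᵇ b) ∧ (c ≡ᵇ d)) → a ≡ b × c ≡ d
  both a b c d h with Equivalence.to T-∧ h
  ... | e₁ , e₂ = ≡ᵇ⇒≡ a b e₁ , ≡ᵇ⇒≡ c d e₂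

  ∨-introˡ : ∀ {a} b → T a → T (a ∨ b)
  ∨-introˡ b h = Equivalence.from T-∨ (inj₁ h)

  ∨-introʳ : ∀ a {b} → T b → T (a ∨ b)
  ∨-introʳ a h = Equivalence.from T-∨ (inj₂ h)

  ≡ᵇ-both : ∀ a c → T ((a ≡ᵇ a) ∧ (c ≡ᵇ c))
  ≡ᵇ-both a c = Equivalence.from (T-∧ {a ≡ᵇ a}) (≡ᵇ-refl a , ≡ᵇ-refl c)

~⇒adjᵖ : ∀ {p q} → p ~ q → T (adjᵖ p q)
~⇒adjᵖ {x , y} {x' , y'} = disjunct
  where
  d₁ = (x' ≡ᵇ suc x) ∧ (y' ≡ᵇ y)
  d₂ = (suc x' ≡ᵇ x) ∧ (y' ≡ᵇ y)
  d₃ = (x' ≡ᵇ x) ∧ (y' ≡ᵇ suc y)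
  d₄ = (x' ≡ᵇ x) ∧ (suc y' ≡ᵇ y)
  d₅ = (x' ≡ᵇ suc x) ∧ (suc y' ≡ᵇ y)
  disjunct : (x , y) ~ (x' , y') → T (adjᵖ (x , y) (x' , y'))
  disjunct east      = ∨-introˡ _ (≡ᵇ-both x' y')
  disjunct west      = ∨-introʳ d₁ (∨-introˡ _ (≡ᵇ-both x y'))
  disjunct north     = ∨-introʳ d₁ (∨-introʳ d₂ (∨-introˡ _ (≡ᵇ-both x' y)))
  disjunct south     = ∨-introʳ d₁ (∨-introʳ d₂ (∨-introʳ d₃ (∨-introˡ _ (≡ᵇ-both x' y'))))
  disjunct southeast = ∨-introʳ d₁ (∨-introʳ d₂ (∨-introʳ d₃ (∨-introʳ d₄ (∨-introˡ _ (≡ᵇ-both x' y)))))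
  disjunct northwest = ∨-introʳ d₁ (∨-introʳ d₂ (∨-introʳ d₃ (∨-introʳ d₄ (∨-introʳ d₅ (≡ᵇ-both x y')))))

adjᵖ⇒~ : ∀ p q → T (adjᵖ p q) → p ~ q
adjᵖ⇒~ (x , y) (x' , y') h with Equivalence.to T-∨ h
... | inj₁ h₁ with both x' (suc x) y' y h₁
...   | refl , refl = east
adjᵖ⇒~ (x , y) (x' , y') h | inj₂ r₁ with Equivalence.to T-∨ r₁
... | inj₁ h₂ with both (suc x') x y' y h₂
...   | refl , refl = west
adjᵖ⇒~ (x , y) (x' , y') h | inj₂ r₁ | inj₂ r₂ with Equivalence.to T-∨ r₂
... | inj₁ h₃ with both x' x y' (suc y) h₃
...   | refl , refl = north
adjᵖ⇒~ (x , y) (x' , y') h | inj₂ r₁ | inj₂ r₂ | inj₂ r₃ with Equivalence.to T-∨ r₃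
... | inj₁ h₄ with both x' x (suc y') y h₄
...   | refl , refl = south
adjᵖ⇒~ (x , y) (x' , y') h | inj₂ r₁ | inj₂ r₂ | inj₂ r₃ | inj₂ r₄ with Equivalence.to T-∨ r₄
... | inj₁ h₅ with both x' (suc x) (suc y') y h₅
...   | refl , refl = southeast
adjᵖ⇒~ (x , y) (x' , y') h | inj₂ r₁ | inj₂ r₂ | inj₂ r₃ | inj₂ r₄ | inj₂ h₆ with both (suc x') x y' (suc y) h₆
...   | refl , refl = northwest

private
  ≤-by : ∀ {a b} c → a + c ≡ b → a ≤ b
  ≤-by {a} c refl = m≤m+n a c

rank : ℕ → Point → ℕ
rank n (x , y) = x * n + y

rankᵛ : {n l : ℕ} → Vertex n l → ℕ
rankᵛ {n} v = rank n (coords v)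

~-rank : ∀ n′ {p q} → p ~ q → rank (suc n′) q ≤ rank (suc n′) p + suc n′
~-rank n′ (east {x} {y})      = ≤-by 0 (e x y n′)
  where e : ∀ x y n′ → suc x * suc n′ + y + 0 ≡ x * suc n′ + y + suc n′
        e = solve-∀
~-rank n′ (west {x} {y})      = ≤-by (2 * suc n′) (e x y n′)
  where e : ∀ x y n′ → x * suc n′ + y + 2 * suc n′ ≡ suc x * suc n′ + y + suc n′
        e = solve-∀
~-rank n′ (north {x} {y})     = ≤-by n′ (e x y n′)
  where e : ∀ x y n′ → x * suc n′ + suc y + n′ ≡ x * suc n′ + y + suc n′
        e = solve-∀
~-rank n′ (south {x} {y})     = ≤-by (2 + n′) (e x y n′)
  where e : ∀ x y n′ → x * suc n′ + y + (2 + n′) ≡ x * suc n′ + suc y + suc n′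
        e = solve-∀
~-rank n′ (southeast {x} {y}) = ≤-by 1 (e x y n′)
  where e : ∀ x y n′ → suc x * suc n′ + y + 1 ≡ x * suc n′ + suc y + suc n′
        e = solve-∀
~-rank n′ (northwest {x} {y}) = ≤-by (suc (2 * n′)) (e x y n′)
  where e : ∀ x y n′ → x * suc n′ + suc y + suc (2 * n′) ≡ suc x * suc n′ + y + suc n′
        e = solve-∀

-- Saturates at m; it is only applied to points of the box.
clamp : ∀ m → ℕ → Fin (suc m)
clamp zero    _       = fzero
clamp (suc m) zero    = fzero
clamp (suc m) (suc x) = fsuc (clamp m x)

toℕ-clamp : ∀ m {x} → x ≤ m → toℕ (clamp m x) ≡ x
toℕ-clamp zero    z≤n     = refl
toℕ-clamp (suc m) z≤n     = refl
toℕ-clamp (suc m) (s≤s h) = cong suc (toℕ-clamp m h)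

clamp-toℕ : ∀ m (i : Fin (suc m)) → clamp m (toℕ i) ≡ i
clamp-toℕ zero    fzero    = refl
clamp-toℕ (suc m) fzero    = refl
clamp-toℕ (suc m) (fsuc i) = cong fsuc (clamp-toℕ m i)

InBox : ℕ → ℕ → Point → Set
InBox n′ l′ (x , y) = x ≤ l′ × y ≤ n′

vertex : ∀ n′ l′ → Point → Vertex (suc n′) (suc l′)
vertex n′ l′ (x , y) = clamp l′ x , clamp n′ y

coords-vertex : ∀ n′ l′ {p} → InBox n′ l′ p → coords (vertex n′ l′ p) ≡ p
coords-vertex n′ l′ (x≤ , y≤) = cong₂ _,_ (toℕ-clamp l′ x≤) (toℕ-clamp n′ y≤)

vertex-coords : ∀ n′ l′ (v : Vertex (suc n′) (suc l′)) → vertex n′ l′ (coords v) ≡ v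
vertex-coords n′ l′ (i , j) = cong₂ _,_ (clamp-toℕ l′ i) (clamp-toℕ n′ j)

coords-inBox : ∀ {n′ l′} (v : Vertex (suc n′) (suc l′)) → InBox n′ l′ (coords v)
coords-inBox (i , j) = ≤-pred (toℕ<n i) , ≤-pred (toℕ<n j)

~⇒Adj : ∀ n′ l′ {p q} → InBox n′ l′ p → InBox n′ l′ q → p ~ q →
        Adj (vertex n′ l′ p) (vertex n′ l′ q)
~⇒Adj n′ l′ p∈ q∈ p~q = subst₂ (λ a b → T (adjᵖ a b))
  (sym (coords-vertex n′ l′ p∈)) (sym (coords-vertex n′ l′ q∈)) (~⇒adjᵖ p~q)

Adj⇒~ : ∀ {n l} (v u : Vertex n l) → Adj v u → coords v ~ coords u
Adj⇒~ v u = adjᵖ⇒~ (coords v) (coords u)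

Adj-rank : ∀ {n′ l} (v u : Vertex (suc n′) l) → Adj v u → rankᵛ u ≤ rankᵛ v + suc n′
Adj-rank {n′} v u adj = ~-rank n′ (Adj⇒~ v u adj)

~-column-bound : ∀ {p q} → p ~ q → proj₁ q ≤ suc (proj₁ p)
~-column-bound (east {x})      = ≤-refl
~-column-bound (west {x})      = m≤n⇒m≤1+n (n≤1+n x)
~-column-bound (north {x})     = n≤1+n x
~-column-bound (south {x})     = n≤1+n x
~-column-bound (southeast {x}) = ≤-refl
~-column-bound (northwest {x}) = m≤n⇒m≤1+n (n≤1+n x)

~-row-bound : ∀ {p q} → p ~ q → proj₂ q ≤ suc (proj₂ p)
~-row-bound (east {y = y})      = n≤1+n y
~-row-bound (west {y = y})      = n≤1+n y
~-row-bound (north {y = y})     = ≤-refl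
~-row-bound (south {y = y})     = m≤n⇒m≤1+n (n≤1+n y)
~-row-bound (southeast {y = y}) = m≤n⇒m≤1+n (n≤1+n y)
~-row-bound (northwest {y = y}) = ≤-refl

rank-bounded : ∀ {n l} (v : Vertex n l) → rankᵛ v < l * n
rank-bounded {n} {l} (i , j) = begin-strict
  toℕ i * n + toℕ j <⟨ +-monoʳ-< (toℕ i * n) (toℕ<n j) ⟩
  toℕ i * n + n     ≡⟨ +-comm (toℕ i * n) n ⟩
  suc (toℕ i) * n   ≤⟨ *-monoˡ-≤ n (toℕ<n i) ⟩
  l * n             ∎
  where open ≤-Reasoning

-- Paths

Consecutive : ℕ → ℕ → Set
Consecutive a b = b ≡ suc a ⊎ a ≡ suc b

par : ℕ → ℕ
par zero          = zero
par (suc zero)    = suc zero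
par (suc (suc t)) = par t

bounce : ℕ → ℕ → ℕ
bounce zero    t       = par t
bounce (suc s) zero    = suc s
bounce (suc s) (suc t) = bounce s t

∣-∣-consecutive : ∀ s t → Consecutive ∣ s - t ∣ ∣ s - suc t ∣
∣-∣-consecutive zero    t       = inj₁ refl
∣-∣-consecutive (suc s) zero    = inj₂ (cong suc (sym (∣-∣-identityʳ s)))
∣-∣-consecutive (suc s) (suc t) = ∣-∣-consecutive s t

par-consecutive : ∀ t → Consecutive (par t) (par (suc t))
par-consecutive zero          = inj₁ refl
par-consecutive (suc zero)    = inj₂ refl
par-consecutive (suc (suc t)) = par-consecutive t

bounce-identityʳ : ∀ s → bounce s 0 ≡ s
bounce-identityʳ zero    = refl
bounce-identityʳ (suc s) = refl

bounce-consecutive : ∀ s t → Consecutive (bounce s t) (bounce s (suc t))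
bounce-consecutive zero    t       = par-consecutive t
bounce-consecutive (suc s) zero    = inj₂ (cong suc (sym (bounce-identityʳ s)))
bounce-consecutive (suc s) (suc t) = bounce-consecutive s t

par≤1 : ∀ t → par t ≤ 1
par≤1 zero          = z≤n
par≤1 (suc zero)    = s≤s z≤n
par≤1 (suc (suc t)) = par≤1 t

∣-∣-bounded : ∀ {m} s t → s ≤ m → t ≤ s + m → ∣ s - t ∣ ≤ m
∣-∣-bounded zero    t       _   t≤  = t≤
∣-∣-bounded (suc s) zero    s≤  _   = s≤
∣-∣-bounded (suc s) (suc t) s≤ (s≤s t≤) = ∣-∣-bounded s t (≤-trans (n≤1+n s) s≤) t≤

bounce-bounded : ∀ {m} s t → s ≤ m → 1 ≤ m → bounce s t ≤ m
bounce-bounded zero    t       _  1≤m = ≤-trans (par≤1 t) 1≤m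
bounce-bounded (suc s) zero    s≤ _   = s≤
bounce-bounded (suc s) (suc t) s≤ 1≤m = bounce-bounded s t (≤-trans (n≤1+n s) s≤) 1≤m

module PathSweep {k n l : ℕ} (level : Vertex n l → ℕ) (m : ℕ) (e : ℕ → Vertex n l)
  (e-level : ∀ v → e (level v) ≡ v)
  (level≤m : ∀ v → level v ≤ m)
  (e-adj : ∀ {x y} → x ≤ m → y ≤ m → Consecutive x y → Adj (e x) (e y))
  (reach : ∀ v u → Adj v u → level u ≤ suc (level v))
  (a₀ : Fin k) (p : Placement k n l) where

  start : Fin k → ℕ
  start a = level (p a)

  track : Fin k → ℕ → ℕ
  track a t with a ≟ᶠ a₀
  ... | yes _ = ∣ start a - t ∣
  ... | no  _ = bounce (start a) t

  σ : Schedule k n l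
  σ t a = e (track a t)

  σ-start : ∀ a → σ 0 a ≡ p a
  σ-start a with a ≟ᶠ a₀
  ... | yes _ = trans (cong e (∣-∣-identityʳ (start a))) (e-level (p a))
  ... | no  _ = trans (cong e (bounce-identityʳ (start a))) (e-level (p a))

  s₀ : ℕ
  s₀ = start a₀

  sweeper-at : ∀ {v} x → level v ≡ x → σ (s₀ + x) a₀ ≡ v
  sweeper-at {v} x refl with a₀ ≟ᶠ a₀
  ... | yes _    = trans (cong e (∣m-m+n∣≡n s₀ x)) (e-level v)
  ... | no a₀≢a₀ = ⊥-elim (a₀≢a₀ refl)

  caffeinated : CaffeinatedUpTo σ (s₀ + m)
  caffeinated t t< a with a ≟ᶠ a₀
  ... | yes refl = e-adj (∣-∣-bounded s₀ t (level≤m (p a₀)) (<⇒≤ t<))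
                         (∣-∣-bounded s₀ (suc t) (level≤m (p a₀)) t<) (∣-∣-consecutive s₀ t)
  ... | no  _    = e-adj (bounce-bounded (start a) t (level≤m (p a)) 1≤m)
                         (bounce-bounded (start a) (suc t) (level≤m (p a)) 1≤m)
                         (bounce-consecutive (start a) t)
    where
    positive : ∀ {s} m → t < s + m → s ≤ m → 1 ≤ m
    positive (suc _) _ _ = s≤s z≤n
    positive zero () z≤n
    1≤m : 1 ≤ m
    1≤m = positive m t< (level≤m (p a₀))

  start-occupied : ∀ v → level v < 1 → Occupied (σ s₀) v
  start-occupied v (s≤s r≤0) =
    a₀ , subst (λ t → σ t a₀ ≡ v) (+-identityʳ s₀) (sweeper-at 0 (n≤0⇒n≡0 r≤0))

  advance : ∀ τ v → level v < suc (suc τ) →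
            Occupied (σ (suc (s₀ + τ))) v
            ⊎ (level v < suc τ × (∀ u → Adj v u → suc τ ≤ level u → Crosses σ (s₀ + τ) v u))
  advance τ v (s≤s r≤) with level v ≟ suc τ
  ... | yes r≡ = inj₁ (a₀ , subst (λ t → σ t a₀ ≡ v) (+-suc s₀ τ) (sweeper-at (suc τ) r≡))
  ... | no  r≢ = inj₂ (s≤s r≤τ , crossing)
    where
    r≤τ : level v ≤ τ
    r≤τ = ≤-pred (≤∧≢⇒< r≤ r≢)
    crossing : ∀ u → Adj v u → suc τ ≤ level u → Crosses σ (s₀ + τ) v u
    crossing u adj τ<u =
      a₀ , sweeper-at τ rv≡ , subst (λ t → σ t a₀ ≡ u) (+-suc s₀ τ) (sweeper-at (suc τ) ru≡)
      where
      ru≤ : level u ≤ suc τ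
      ru≤ = ≤-trans (reach v u adj) (s≤s r≤τ)
      ru≡ : level u ≡ suc τ
      ru≡ = ≤-antisym ru≤ τ<u
      rv≡ : level v ≡ τ
      rv≡ = ≤-antisym r≤τ (≤-pred (≤-trans τ<u (reach v u adj)))

  open Sweep σ level s₀ suc start-occupied advance

  clears : ClearingSchedule p
  clears = σ , σ-start , s₀ + m , caffeinated , λ v → Equivalence.to T-≡ (sweep m v (s≤s (level≤m v)))

consecutive-east : ∀ {x y} z → Consecutive x y → (x , z) ~ (y , z)
consecutive-east z (inj₁ refl) = east
consecutive-east z (inj₂ refl) = west

consecutive-north : ∀ {x y} z → Consecutive x y → (z , x) ~ (z , y)
consecutive-north z (inj₁ refl) = north
consecutive-north z (inj₂ refl) = south

row-clearing : ∀ {k} l′ → Fin k → (p : Placement k 1 (suc l′)) → ClearingSchedule p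
row-clearing l′ a₀ p =
  PathSweep.clears position l′ path path-position (proj₁ ∘ coords-inBox) path-adj reach a₀ p
  where
  position : Vertex 1 (suc l′) → ℕ
  position v = proj₁ (coords v)
  path : ℕ → Vertex 1 (suc l′)
  path x = vertex 0 l′ (x , 0)
  path-position : ∀ v → path (position v) ≡ v
  path-position (i , fzero) = vertex-coords 0 l′ (i , fzero)
  path-adj : ∀ {x y} → x ≤ l′ → y ≤ l′ → Consecutive x y → Adj (path x) (path y)
  path-adj x≤ y≤ c = ~⇒Adj 0 l′ (x≤ , z≤n) (y≤ , z≤n) (consecutive-east 0 c)
  reach : ∀ v u → Adj v u → position u ≤ suc (position v)
  reach v u adj = ~-column-bound (Adj⇒~ v u adj)

column-clearing : ∀ {k} n′ → Fin k → (p : Placement k (suc n′) 1) → ClearingSchedule p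
column-clearing n′ a₀ p =
  PathSweep.clears position n′ path path-position (proj₂ ∘ coords-inBox) path-adj reach a₀ p
  where
  position : Vertex (suc n′) 1 → ℕ
  position v = proj₂ (coords v)
  path : ℕ → Vertex (suc n′) 1
  path y = vertex n′ 0 (0 , y)
  path-position : ∀ v → path (position v) ≡ v
  path-position (fzero , j) = vertex-coords n′ 0 (fzero , j)
  path-adj : ∀ {x y} → x ≤ n′ → y ≤ n′ → Consecutive x y → Adj (path x) (path y)
  path-adj x≤ y≤ c = ~⇒Adj n′ 0 (z≤n , x≤) (z≤n , y≤) (consecutive-north 0 c)
  reach : ∀ v u → Adj v u → position u ≤ suc (position v)
  reach v u adj = ~-row-bound (Adj⇒~ v u adj)

-- Walks

Walk : ℕ → (ℕ → Point) → Set
Walk T f = ∀ t → t < T → f t ~ f (suc t)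

infixr 5 _▹⟨_⟩_

_▹⟨_⟩_ : (ℕ → Point) → ℕ → (ℕ → Point) → ℕ → Point
(f ▹⟨ T ⟩ g) t with t ≤? T
... | yes _ = f t
... | no  _ = g (t ∸ T)

▹-start : ∀ f T g → (f ▹⟨ T ⟩ g) 0 ≡ f 0
▹-start f T g with 0 ≤? T
... | yes _   = refl
... | no  0≰T = ⊥-elim (0≰T z≤n)

▹-shift : ∀ f T g → f T ≡ g 0 → ∀ τ → (f ▹⟨ T ⟩ g) (T + τ) ≡ g τ
▹-shift f T g joint τ with T + τ ≤? T
... | no  _ = cong g (m+n∸m≡n T τ)
... | yes ≤T with τ
...   | zero  = trans (cong f (+-identityʳ T)) joint
...   | suc τ = ⊥-elim (<⇒≱ (m<m+n T (s≤s z≤n)) ≤T)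

▹-walk : ∀ {f g} T {T′} → f T ≡ g 0 → Walk T f → Walk T′ g → Walk (T + T′) (f ▹⟨ T ⟩ g)
▹-walk {f} {g} T {T′} joint f-walk g-walk t t< with t ≤? T | suc t ≤? T
... | yes _   | yes t<T  = f-walk t t<T
... | yes t≤T | no  t≮T  = subst₂ _~_ (sym (trans (cong f t≡T) joint)) (cong g (sym 1+t∸T≡1)) (g-walk 0 0<T′)
  where
  t≡T : t ≡ T
  t≡T = ≤-antisym t≤T (≮⇒≥ t≮T)
  1+t∸T≡1 : suc t ∸ T ≡ 1
  1+t∸T≡1 = trans (cong (λ s → suc s ∸ T) t≡T) (trans (+-∸-assoc 1 (≤-refl {T})) (cong suc (n∸n≡0 T)))
  0<T′ : 0 < T′
  0<T′ = +-cancelˡ-< T 0 T′ (subst (_< T + T′) (trans t≡T (sym (+-identityʳ T))) t<)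
... | no  t≰T | yes t<T  = ⊥-elim (t≰T (≤-trans (n≤1+n t) t<T))
... | no  t≰T | no  _    = subst (g (t ∸ T) ~_) (cong g (sym (+-∸-assoc 1 T≤t))) (g-walk (t ∸ T) t∸T<T′)
  where
  T≤t : T ≤ t
  T≤t = <⇒≤ (≰⇒> t≰T)
  t∸T<T′ : t ∸ T < T′
  t∸T<T′ = subst (t ∸ T <_) (m+n∸m≡n T T′) (∸-monoˡ-< t< T≤t)

▹-within : ∀ (Q : Point → Set) f T g T′ → (∀ t → t ≤ T → Q (f t)) → (∀ t → t ≤ T′ → Q (g t)) →
           ∀ t → t ≤ T + T′ → Q ((f ▹⟨ T ⟩ g) t)
▹-within Q f T g T′ f-in g-in t t≤ with t ≤? T
... | yes t≤T = f-in t t≤T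
... | no  _   = g-in (t ∸ T) (subst (t ∸ T ≤_) (m+n∸m≡n T T′) (∸-monoˡ-≤ T t≤))

reverse : ℕ → (ℕ → Point) → ℕ → Point
reverse T f t = f (T ∸ t)

reverse-walk : ∀ {f} T → Walk T f → Walk T (reverse T f)
reverse-walk {f} T f-walk t t<T =
  subst (λ s → f s ~ f (T ∸ suc t)) (sym (+-∸-assoc 1 t<T))
    (~-sym (f-walk (T ∸ suc t) (∸-monoʳ-< (s≤s z≤n) t<T)))

reverse-within : ∀ (Q : Point → Set) f T → (∀ t → t ≤ T → Q (f t)) → ∀ t → t ≤ T → Q (reverse T f t)
reverse-within Q f T f-in t _ = f-in (T ∸ t) (m∸n≤m T t)

oscillation : ℕ → Point
oscillation s = par s , 0

triangle : ℕ → Point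
triangle 0 = 0 , 0
triangle 1 = 0 , 1
triangle 2 = 1 , 0
triangle (suc (suc (suc s))) = oscillation s

-- A closed walk of every length e ≠ 1 at the origin; odd lengths go once around a triangle.
loop : ℕ → ℕ → Point
loop e with par e
... | zero  = oscillation
... | suc _ = triangle

oscillation-step : ∀ s → oscillation s ~ oscillation (suc s)
oscillation-step s with par-consecutive s
... | inj₁ next = subst (λ x → (par s , 0) ~ (x , 0)) (sym next) east
... | inj₂ prev = subst (λ x → (x , 0) ~ (par (suc s) , 0)) (sym prev) west

loop-step : ∀ e t → loop e t ~ loop e (suc t)
loop-step e t with par e
... | zero  = oscillation-step t
... | suc _ = triangle-step t
  where
  triangle-step : ∀ t → triangle t ~ triangle (suc t)
  triangle-step 0 = north
  triangle-step 1 = southeast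
  triangle-step 2 = west
  triangle-step (suc (suc (suc s))) = oscillation-step s

loop-start : ∀ e → loop e 0 ≡ (0 , 0)
loop-start e with par e
... | zero  = refl
... | suc _ = refl

par+par-suc : ∀ s → par s + par (suc s) ≡ 1
par+par-suc zero          = refl
par+par-suc (suc zero)    = refl
par+par-suc (suc (suc s)) = par+par-suc s

loop-closes : ∀ e → 3 ≤ e → loop e e ≡ (0 , 0)
loop-closes e _ with par e in parity
... | zero = cong (_, 0) parity
loop-closes (suc zero) (s≤s ()) | suc _
loop-closes (suc (suc (suc s))) _ | suc z =
  cong (_, 0) (m+n≡0⇒m≡0 (par s) (suc-injective (begin
    suc (par s + z)   ≡⟨ +-suc (par s) z ⟨
    par s + suc z     ≡⟨ cong (par s +_) parity ⟨
    par s + par (suc s) ≡⟨ par+par-suc s ⟩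
    1                 ∎)))
  where open ≡-Reasoning

loop-within : ∀ e t → InBox 1 1 (loop e t)
loop-within e t with par e
... | zero  = par≤1 t , z≤n
... | suc _ = triangle-within t
  where
  triangle-within : ∀ t → InBox 1 1 (triangle t)
  triangle-within 0 = z≤n , z≤n
  triangle-within 1 = z≤n , s≤s z≤n
  triangle-within 2 = s≤s z≤n , z≤n
  triangle-within (suc (suc (suc s))) = par≤1 s , z≤n

hook : ℕ → ℕ → Point
hook zero    w       = w , 0
hook (suc y) zero    = 0 , 0
hook (suc y) (suc w) = (0 , 1) ⊕ hook y w

hook-start : ∀ y → hook y 0 ≡ (0 , 0)
hook-start zero    = refl
hook-start (suc y) = refl

hook-step : ∀ y w → hook y w ~ hook y (suc w)
hook-step zero    w       = east
hook-step (suc y) zero    = subst (λ p → (0 , 0) ~ (0 , 1) ⊕ p) (sym (hook-start y)) north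
hook-step (suc y) (suc w) = ~-translate (0 , 1) (hook-step y w)

hook-end : ∀ x y → hook y (x + y) ≡ (x , y)
hook-end x zero    = cong (_, 0) (+-identityʳ x)
hook-end x (suc y) rewrite +-suc x y | hook-end x y = refl

hook-within : ∀ x y w → w ≤ x + y → InBox y x (hook y w)
hook-within x zero    w       w≤ = subst (w ≤_) (+-identityʳ x) w≤ , z≤n
hook-within x (suc y) zero    _  = z≤n , z≤n
hook-within x (suc y) (suc w) w≤ with hook-within x y w (≤-pred (subst (suc w ≤_) (+-suc x y) w≤))
... | x≤ , y≤ = x≤ , s≤s y≤

size : Point → ℕ
size (x , y) = x + y

approach : ℕ → Point → ℕ → Point
approach M v = loop (M ∸ size v) ▹⟨ M ∸ size v ⟩ hook (proj₂ v)

InBox-mono : ∀ {n′ l′ n″ l″ p} → n′ ≤ n″ → l′ ≤ l″ → InBox n′ l′ p → InBox n″ l″ p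
InBox-mono n≤ l≤ (x≤ , y≤) = ≤-trans x≤ l≤ , ≤-trans y≤ n≤

module _ (M : ℕ) (v : Point) (roomy : size v + 3 ≤ M) where

  private
    e : ℕ
    e = M ∸ size v
    e+size≡M : e + size v ≡ M
    e+size≡M = m∸n+n≡m (≤-trans (m≤m+n (size v) 3) roomy)
    joint : loop e e ≡ hook (proj₂ v) 0
    joint = trans (loop-closes e (m+n≤o⇒m≤o∸n 3 (subst (_≤ M) (+-comm (size v) 3) roomy)))
                  (sym (hook-start (proj₂ v)))

  approach-walk : Walk M (approach M v)
  approach-walk = subst (λ T → Walk T (approach M v)) e+size≡M
    (▹-walk e joint (λ t _ → loop-step e t) (λ t _ → hook-step (proj₂ v) t))

  approach-start : approach M v 0 ≡ (0 , 0)
  approach-start = trans (▹-start (loop e) e (hook (proj₂ v))) (loop-start e)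

  approach-end : approach M v M ≡ v
  approach-end = trans (cong (approach M v) (sym e+size≡M))
    (trans (▹-shift (loop e) e (hook (proj₂ v)) joint (size v)) (hook-end (proj₁ v) (proj₂ v)))

  approach-within : ∀ {n′ l′} → 1 ≤ n′ → 1 ≤ l′ → InBox n′ l′ v → ∀ t → t ≤ M → InBox n′ l′ (approach M v t)
  approach-within {n′} {l′} 1≤n′ 1≤l′ (x≤ , y≤) t t≤M =
    ▹-within (InBox n′ l′) (loop e) e (hook (proj₂ v)) (size v)
      (λ s _ → InBox-mono 1≤n′ 1≤l′ (loop-within e s))
      (λ s s≤ → InBox-mono y≤ x≤ (hook-within (proj₁ v) (proj₂ v) s s≤))
      t (subst (t ≤_) (sym e+size≡M) t≤M)

transfer : ℕ → Point → Point → ℕ → Point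
transfer M b q = reverse M (approach M b) ▹⟨ M ⟩ approach M q

module Transfer (M : ℕ) (b q : Point) (b-roomy : size b + 3 ≤ M) (q-roomy : size q + 3 ≤ M) where

  private
    joint : reverse M (approach M b) M ≡ approach M q 0
    joint = trans (cong (approach M b) (n∸n≡0 M))
                  (trans (approach-start M b b-roomy) (sym (approach-start M q q-roomy)))

  walk : Walk (M + M) (transfer M b q)
  walk = ▹-walk M joint (reverse-walk M (approach-walk M b b-roomy)) (approach-walk M q q-roomy)

  begins : transfer M b q 0 ≡ b
  begins = trans (▹-start (reverse M (approach M b)) M (approach M q)) (approach-end M b b-roomy)

  ends : transfer M b q (M + M) ≡ q
  ends = trans (▹-shift (reverse M (approach M b)) M (approach M q) joint M) (approach-end M q q-roomy)

  within : ∀ {n′ l′} → 1 ≤ n′ → 1 ≤ l′ → InBox n′ l′ b → InBox n′ l′ q →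
           ∀ t → t ≤ M + M → InBox n′ l′ (transfer M b q t)
  within {n′} {l′} 1≤n′ 1≤l′ b∈ q∈ =
    ▹-within (InBox n′ l′) (reverse M (approach M b)) M (approach M q) M
      (reverse-within (InBox n′ l′) (approach M b) M (approach-within M b b-roomy 1≤n′ 1≤l′ b∈))
      (approach-within M q q-roomy 1≤n′ 1≤l′ q∈)

-- Division with remainder

quotRem-of : ∀ {k} .{{_ : NonZero k}} d m → d < k → (d + m * k) / k ≡ m × (d + m * k) % k ≡ d
quotRem-of {k} d m d<k = quot , trans ([m+kn]%n≡m%n d m k) (m<n⇒m%n≡m d<k)
  where
  quot : (d + m * k) / k ≡ m
  quot = trans (+-distrib-/-∣ʳ d (divides m refl)) (cong₂ _+_ (m<n⇒m/n≡0 d<k) (m*n/n≡m m k))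

quotRem-unique : ∀ {k} .{{_ : NonZero k}} {d d′} m m′ → d < k → d′ < k →
                 d + m * k ≡ d′ + m′ * k → m ≡ m′ × d ≡ d′
quotRem-unique {k} {d} {d′} m m′ d<k d′<k eq with quotRem-of d m d<k | quotRem-of d′ m′ d′<k
... | q , r | q′ , r′ = trans (sym q) (trans (cong (_/ k) eq) q′) , trans (sym r) (trans (cong (_% k) eq) r′)

staircase : ∀ {n c x y a b} → y < n → b ≤ n →
            c * n + a ≤ x * n + y → x * n + y < suc c * n + b →
            (x ≡ c × a ≤ y) ⊎ (x ≡ suc c × y < b)
staircase {n} {c} {x} {y} {a} {b} y<n b≤n lower upper with <-cmp x c
... | tri≈ _ refl _ = inj₁ (refl , +-cancelˡ-≤ (x * n) a y lower)
... | tri< x<c _ _ = ⊥-elim (<-irrefl refl (begin-strict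
        x * n + y <⟨ +-monoʳ-< (x * n) y<n ⟩
        x * n + n ≡⟨ +-comm (x * n) n ⟩
        suc x * n ≤⟨ *-monoˡ-≤ n x<c ⟩
        c * n     ≤⟨ m≤m+n (c * n) a ⟩
        c * n + a ≤⟨ lower ⟩
        x * n + y ∎))
  where open ≤-Reasoning
... | tri> _ _ c<x with m≤n⇒m<n∨m≡n c<x
...   | inj₂ refl = inj₂ (refl , +-cancelˡ-< (suc c * n) y b upper)
...   | inj₁ c+1<x = ⊥-elim (<-irrefl refl (begin-strict
        x * n + y       <⟨ upper ⟩
        suc c * n + b   ≤⟨ +-monoʳ-≤ (suc c * n) b≤n ⟩
        suc c * n + n   ≡⟨ +-comm (suc c * n) n ⟩
        suc (suc c) * n ≤⟨ *-monoˡ-≤ n c+1<x ⟩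
        x * n           ≤⟨ m≤m+n (x * n) y ⟩
        x * n + y       ∎))
  where open ≤-Reasoning

-- Formations of a block

data Kind : Set where
  pair triple : Kind

height : Kind → ℕ
height pair   = 2
height triple = 3

lions : Kind → ℕ
lions κ = suc (height κ)

data Phase : Set where
  pending : Phase
  active  : ℕ → Phase
  passed  : Phase

data Valid (g : ℕ) : Phase → Set where
  pending : Valid g pending
  active  : ∀ {u} → u < g → Valid g (active u)
  passed  : Valid g passed

data Succ (g : ℕ) : Phase → Phase → Set where
  wait    : Succ g pending pending
  enter   : Succ g pending (active 0)
  advance : ∀ {u} → suc u < g → Succ g (active u) (active (suc u))
  leave   : ∀ {u} → suc u ≡ g → Succ g (active u) passed
  rest    : Succ g passed passed

data Final (g : ℕ) : Phase → Set where
  passed : Final g passed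
  last   : ∀ {u} → suc u ≡ g → Final g (active u)

data Initial : Phase → Set where
  pending : Initial pending
  first   : Initial (active 0)

ticked : ℕ → ℕ
ticked zero    = 0
ticked (suc _) = 1

ticked≤1 : ∀ q → ticked q ≤ 1
ticked≤1 zero    = z≤n
ticked≤1 (suc q) = s≤s z≤n

settled : ℕ → ℕ
settled (suc (suc _)) = 1
settled _             = 0

required : Phase → ℕ → Point → Bool
required pending    q (δ , d) = δ ≡ᵇ 0
required passed     q (δ , d) = δ ≡ᵇ 1
required (active u) q (δ , d) = ((δ ≡ᵇ 1) ∧ (d <ᵇ u + ticked q)) ∨ ((δ ≡ᵇ 0) ∧ (u + settled q ≤ᵇ d))

pick : List Point → ℕ → Point
pick []       _       = 0 , 0
pick (p ∷ ps) zero    = p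
pick (p ∷ ps) (suc ρ) = pick ps ρ

idle : Kind → ℕ → List Point
idle pair   zero          = (0 , 0) ∷ (0 , 1) ∷ (0 , 0) ∷ []
idle pair   (suc zero)    = (0 , 1) ∷ (0 , 0) ∷ (0 , 1) ∷ []
idle triple zero          = (0 , 0) ∷ (0 , 1) ∷ (0 , 2) ∷ (0 , 1) ∷ []
idle triple (suc zero)    = (0 , 1) ∷ (0 , 0) ∷ (0 , 1) ∷ (0 , 2) ∷ []
idle κ      (suc (suc q)) = idle κ q

crossing : Kind → ℕ → ℕ → List Point
crossing pair   0 0 = (0 , 0) ∷ (0 , 1) ∷ (0 , 0) ∷ []
crossing pair   0 1 = (0 , 1) ∷ (0 , 0) ∷ (1 , 0) ∷ []
crossing pair   0 2 = (0 , 0) ∷ (1 , 0) ∷ (0 , 1) ∷ []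
crossing pair   0 3 = (0 , 1) ∷ (0 , 0) ∷ (1 , 0) ∷ []
crossing pair   1 0 = (0 , 0) ∷ (1 , 0) ∷ (0 , 1) ∷ []
crossing pair   1 1 = (0 , 1) ∷ (1 , 1) ∷ (1 , 0) ∷ []
crossing pair   1 2 = (1 , 0) ∷ (0 , 1) ∷ (1 , 1) ∷ []
crossing pair   1 3 = (1 , 1) ∷ (1 , 0) ∷ (0 , 1) ∷ []
crossing triple 0 0 = (0 , 0) ∷ (0 , 1) ∷ (0 , 2) ∷ (0 , 1) ∷ []
crossing triple 0 1 = (1 , 0) ∷ (0 , 0) ∷ (0 , 1) ∷ (0 , 2) ∷ []
crossing triple 0 2 = (0 , 0) ∷ (1 , 0) ∷ (0 , 2) ∷ (0 , 1) ∷ []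
crossing triple 0 3 = (1 , 0) ∷ (0 , 0) ∷ (0 , 1) ∷ (0 , 2) ∷ []
crossing triple 1 0 = (0 , 0) ∷ (1 , 0) ∷ (0 , 2) ∷ (0 , 1) ∷ []
crossing triple 1 1 = (1 , 0) ∷ (0 , 1) ∷ (1 , 1) ∷ (0 , 2) ∷ []
crossing triple 1 2 = (0 , 0) ∷ (0 , 2) ∷ (1 , 0) ∷ (1 , 1) ∷ []
crossing triple 1 3 = (1 , 0) ∷ (0 , 1) ∷ (1 , 1) ∷ (0 , 2) ∷ []
crossing triple 2 0 = (0 , 1) ∷ (0 , 2) ∷ (1 , 0) ∷ (1 , 1) ∷ []
crossing triple 2 1 = (0 , 2) ∷ (1 , 2) ∷ (1 , 1) ∷ (1 , 0) ∷ []
crossing triple 2 2 = (1 , 2) ∷ (0 , 2) ∷ (1 , 0) ∷ (1 , 1) ∷ []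
crossing triple 2 3 = (1 , 1) ∷ (1 , 2) ∷ (1 , 1) ∷ (1 , 0) ∷ []
crossing _      _ _ = []

-- Offset of lion ρ of a block of kind κ from (column, first row of the block) at tick q,
-- when the front is in phase φ with respect to the block.
tab : Kind → Phase → ℕ → ℕ → Point
tab κ pending    q ρ = pick (idle κ q) ρ
tab κ (active u) q ρ = pick (crossing κ u q) ρ
tab κ passed     q ρ = (1 , 0) ⊕ pick (idle κ q) ρ

infix 4 _~?_ _≟ᵖ_

_~?_ : ∀ p q → Dec (p ~ q)
p ~? q = map′ (adjᵖ⇒~ p q) ~⇒adjᵖ (T? (adjᵖ p q))

_≟ᵖ_ : ∀ (p q : Point) → Dec (p ≡ q)
_≟ᵖ_ = ≡-dec _≟_ _≟_

tab-move : ∀ κ {φ} → Valid (height κ) φ → ∀ {q} → q < 3 → ∀ {ρ} → ρ < lions κ →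
           tab κ φ q ρ ~ tab κ φ (suc q) ρ
tab-move κ valid = toWitness (checked κ valid)
  where
  checked : ∀ κ {φ} → Valid (height κ) φ →
            True (allUpTo? (λ q → allUpTo? (λ ρ → tab κ φ q ρ ~? tab κ φ (suc q) ρ) (lions κ)) 3)
  checked pair   pending = _
  checked pair   passed  = _
  checked pair   (active {0} _) = _
  checked pair   (active {1} _) = _
  checked pair   (active {suc (suc _)} (s≤s (s≤s ())))
  checked triple pending = _
  checked triple passed  = _
  checked triple (active {0} _) = _
  checked triple (active {1} _) = _
  checked triple (active {2} _) = _
  checked triple (active {suc (suc (suc _))} (s≤s (s≤s (s≤s ()))))

tab-succ : ∀ κ {φ φ′} → Succ (height κ) φ φ′ → ∀ {ρ} → ρ < lions κ → tab κ φ 3 ρ ~ tab κ φ′ 0 ρ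
tab-succ κ succ = toWitness (checked κ succ)
  where
  checked : ∀ κ {φ φ′} → Succ (height κ) φ φ′ →
            True (allUpTo? (λ ρ → tab κ φ 3 ρ ~? tab κ φ′ 0 ρ) (lions κ))
  checked pair   wait  = _
  checked pair   enter = _
  checked pair   rest  = _
  checked pair   (advance {0} _) = _
  checked pair   (advance {suc _} (s≤s (s≤s ())))
  checked pair   (leave {1} refl) = _
  checked triple wait  = _
  checked triple enter = _
  checked triple rest  = _
  checked triple (advance {0} _) = _
  checked triple (advance {1} _) = _
  checked triple (advance {suc (suc _)} (s≤s (s≤s (s≤s ()))))
  checked triple (leave {2} refl) = _

tab-wrap : ∀ κ {φ φ′} → Final (height κ) φ → Initial φ′ → ∀ {ρ} → ρ < lions κ →
           tab κ φ 3 ρ ~ (1 , 0) ⊕ tab κ φ′ 0 ρ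
tab-wrap κ final initial = toWitness (checked κ final initial)
  where
  checked : ∀ κ {φ φ′} → Final (height κ) φ → Initial φ′ →
            True (allUpTo? (λ ρ → tab κ φ 3 ρ ~? (1 , 0) ⊕ tab κ φ′ 0 ρ) (lions κ))
  checked pair   passed           pending = _
  checked pair   passed           first   = _
  checked pair   (last {1} refl)  pending = _
  checked pair   (last {1} refl)  first   = _
  checked triple passed           pending = _
  checked triple passed           first   = _
  checked triple (last {2} refl)  pending = _
  checked triple (last {2} refl)  first   = _

tab-cover : ∀ κ {φ} → Valid (height κ) φ → ∀ {q} → q < 4 → ∀ {δ} → δ < 2 → ∀ {d} → d < height κ →
            T (required φ q (δ , d)) → ∃ λ ρ → ρ < lions κ × tab κ φ q ρ ≡ (δ , d)
tab-cover κ valid = toWitness (checked κ valid)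
  where
  checked : ∀ κ {φ} → Valid (height κ) φ →
            True (allUpTo? (λ q → allUpTo? (λ δ → allUpTo? (λ d →
              T? (required φ q (δ , d)) →-dec anyUpTo? (λ ρ → tab κ φ q ρ ≟ᵖ (δ , d)) (lions κ))
              (height κ)) 2) 4)
  checked pair   pending = _
  checked pair   passed  = _
  checked pair   (active {0} _) = _
  checked pair   (active {1} _) = _
  checked pair   (active {suc (suc _)} (s≤s (s≤s ())))
  checked triple pending = _
  checked triple passed  = _
  checked triple (active {0} _) = _
  checked triple (active {1} _) = _
  checked triple (active {2} _) = _
  checked triple (active {suc (suc (suc _))} (s≤s (s≤s (s≤s ()))))

tab-range : ∀ κ {φ} → Valid (height κ) φ → ∀ {q} → q < 4 → ∀ {ρ} → ρ < lions κ →
            proj₁ (tab κ φ q ρ) ≤ 1 × proj₂ (tab κ φ q ρ) < height κ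
tab-range κ valid = toWitness (checked κ valid)
  where
  checked : ∀ κ {φ} → Valid (height κ) φ →
            True (allUpTo? (λ q → allUpTo? (λ ρ →
              (proj₁ (tab κ φ q ρ) ≤? 1) ×-dec (proj₂ (tab κ φ q ρ) <? height κ)) (lions κ)) 4)
  checked pair   pending = _
  checked pair   passed  = _
  checked pair   (active {0} _) = _
  checked pair   (active {1} _) = _
  checked pair   (active {suc (suc _)} (s≤s (s≤s ())))
  checked triple pending = _
  checked triple passed  = _
  checked triple (active {0} _) = _
  checked triple (active {1} _) = _
  checked triple (active {2} _) = _
  checked triple (active {suc (suc (suc _))} (s≤s (s≤s (s≤s ()))))

-- The cells (c + δ , y) that must be occupied when the clock reads ⟨ c , r , q ⟩: the n cells
-- just behind the front and, at tick 1, also the cell (c , r) it has just passed.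
InBand : ℕ → ℕ → Point → Set
InBand r q (δ , y) = (δ ≡ 1 × y < r + ticked q) ⊎ (δ ≡ 0 × r + settled q ≤ y)

entered : ℕ → ℕ → Phase
entered g r with r <? g
... | yes _ = active r
... | no  _ = passed

phase : (j₀ g r : ℕ) → Phase
phase (suc j₀) g zero    = pending
phase (suc j₀) g (suc r) = phase j₀ g r
phase zero     g r       = entered g r

phase-valid : ∀ j₀ {g} r → Valid g (phase j₀ g r)
phase-valid (suc j₀) zero    = pending
phase-valid (suc j₀) (suc r) = phase-valid j₀ r
phase-valid zero {g} r with r <? g
... | yes r<g = active r<g
... | no  _   = passed

phase-succ : ∀ j₀ {g} r → 1 ≤ g → Succ g (phase j₀ g r) (phase j₀ g (suc r))
phase-succ (suc j₀)       (suc r) 1≤g = phase-succ j₀ r 1≤g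
phase-succ (suc (suc j₀)) zero    _   = wait
phase-succ (suc zero) {g} zero    1≤g with 0 <? g
... | yes _   = enter
... | no  0≮g = ⊥-elim (0≮g 1≤g)
phase-succ zero {g} r _ with r <? g | suc r <? g
... | yes _   | yes r+1<g = advance r+1<g
... | yes r<g | no  r+1≮g = leave (≤-antisym r<g (≮⇒≥ r+1≮g))
... | no  r≮g | yes r+1<g = ⊥-elim (r≮g (<-trans (n<1+n r) r+1<g))
... | no  _   | no  _     = rest

phase-final : ∀ j₀ {g} r → 1 ≤ g → j₀ + g ≤ suc r → Final g (phase j₀ g r)
phase-final (suc j₀) (suc r) 1≤g (s≤s fits) = phase-final j₀ r 1≤g fits
phase-final (suc j₀) {g} zero 1≤g (s≤s fits) = ⊥-elim (<⇒≱ 1≤g (≤-trans (m≤n+m g j₀) fits))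
phase-final zero {g} r _ fits with r <? g
... | yes r<g = last (≤-antisym r<g fits)
... | no  _   = passed

phase-initial : ∀ j₀ {g} → 1 ≤ g → Initial (phase j₀ g 0)
phase-initial (suc j₀) _ = pending
phase-initial zero {g} 1≤g with 0 <? g
... | yes _   = first
... | no  0≮g = ⊥-elim (0≮g 1≤g)

band-required : ∀ j₀ {g} r q δ d → d < g → InBand r q (δ , j₀ + d) → T (required (phase j₀ g r) q (δ , d))
band-required (suc j₀) (suc r) q δ d d<g (inj₁ (δ≡1 , s≤s y<)) = band-required j₀ r q δ d d<g (inj₁ (δ≡1 , y<))
band-required (suc j₀) (suc r) q δ d d<g (inj₂ (δ≡0 , s≤s ≤y)) = band-required j₀ r q δ d d<g (inj₂ (δ≡0 , ≤y))
band-required (suc j₀) zero q .1 d _ (inj₁ (refl , y<)) = ⊥-elim (<⇒≱ y< (≤-trans (ticked≤1 q) (s≤s z≤n)))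
band-required (suc j₀) zero q .0 d _ (inj₂ (refl , _)) = _
band-required zero {g} r q δ d d<g band with r <? g
band-required zero r q .1 d _ (inj₁ (refl , d<)) | yes _ = Equivalence.from T-∨ (inj₁ (<⇒<ᵇ d<))
band-required zero r q .0 d _ (inj₂ (refl , ≤d)) | yes _ = Equivalence.from T-∨ (inj₂ (≤⇒≤ᵇ ≤d))
band-required zero r q .1 d _ (inj₁ (refl , _))  | no _  = _
band-required zero r q .0 d d<g (inj₂ (refl , ≤d)) | no r≮g =
  ⊥-elim (r≮g (≤-<-trans (≤-trans (m≤m+n r (settled q)) ≤d) d<g))

-- Grids

module Blocks (n : ℕ) (2≤n : 2 ≤ n) where

  H : ℕ
  H = n / 2

  P : ℕ
  P = n % 2

  n≡2H+P : n ≡ 2 * H + P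
  n≡2H+P = trans (m≡m%n+[m/n]*n n 2) (e P H)
    where e : ∀ p h → p + h * 2 ≡ 2 * h + p
          e = solve-∀

  P≤1 : P ≤ 1
  P≤1 = ≤-pred (m%n<n n 2)

  1≤H : 1 ≤ H
  1≤H = m≥n⇒m/n>0 2≤n

  private
    swap-halves : ∀ m d → d + m * 2 ≡ 2 * m + d
    swap-halves = solve-∀

    H∸1+1 : suc (H ∸ 1) ≡ H
    H∸1+1 = trans (+-comm 1 (H ∸ 1)) (m∸n+n≡m 1≤H)

    H∸1<H : H ∸ 1 < H
    H∸1<H = subst (H ∸ 1 <_) H∸1+1 ≤-refl

    two-below : ∀ h → 2 * h + 2 ≡ 2 * suc h
    two-below = solve-∀

  lion-count : (3 * n) / 2 ≡ n + H
  lion-count = trans (cong (_/ 2) (e n)) (trans (+-distrib-/-∣ˡ n (divides n refl)) (cong (_+ H) (m*n/n≡m n 2)))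
    where e : ∀ n → 3 * n ≡ n * 2 + n
          e = solve-∀

  kind : ℕ → Kind
  kind m with P ≟ 1 | suc m ≟ H
  ... | yes _ | yes _ = triple
  ... | _     | _     = pair

  kind-triple : ∀ m → kind m ≡ triple → P ≡ 1 × suc m ≡ H
  kind-triple m eq with P ≟ 1 | suc m ≟ H
  kind-triple m _  | yes P≡1 | yes m+1≡H = P≡1 , m+1≡H
  kind-triple m () | yes _   | no _
  kind-triple m () | no _    | _

  last-triple : P ≡ 1 → kind (H ∸ 1) ≡ triple
  last-triple P≡1 with P ≟ 1 | suc (H ∸ 1) ≟ H
  ... | yes _ | yes _ = refl
  ... | no P≢1 | _ = ⊥-elim (P≢1 P≡1)
  ... | yes _ | no ≢H = ⊥-elim (≢H H∸1+1)

  2≤height : ∀ κ → 2 ≤ height κ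
  2≤height pair   = ≤-refl
  2≤height triple = n≤1+n 2

  block-fits : ∀ m → m < H → 2 * m + height (kind m) ≤ n
  block-fits m m<H with kind m in eq
  ... | pair = begin
    2 * m + 2 ≡⟨ two-below m ⟩
    2 * suc m ≤⟨ *-monoʳ-≤ 2 m<H ⟩
    2 * H     ≤⟨ m≤m+n (2 * H) P ⟩
    2 * H + P ≡⟨ sym n≡2H+P ⟩
    n         ∎
    where open ≤-Reasoning
  ... | triple with kind-triple m eq
  ...   | P≡1 , m+1≡H = ≤-reflexive (begin
    2 * m + 3       ≡⟨ e m ⟩
    2 * suc m + 1   ≡⟨ cong₂ (λ h p → 2 * h + p) m+1≡H (sym P≡1) ⟩
    2 * H + P       ≡⟨ sym n≡2H+P ⟩
    n               ∎)
    where open ≡-Reasoning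
          e : ∀ m → 2 * m + 3 ≡ 2 * suc m + 1
          e = solve-∀

  rowBlock : ℕ → ℕ × ℕ
  rowBlock y with y / 2 <? H
  ... | yes _ = y / 2 , y % 2
  ... | no  _ = H ∸ 1 , 2

  RowSplit : ℕ → ℕ × ℕ → Set
  RowSplit y (m , d) = m < H × d < height (kind m) × y ≡ 2 * m + d

  top-row : ∀ {y} → y < n → 2 * H ≤ y → P ≡ 1 × y ≡ 2 * H
  top-row {y} y<n 2H≤y = P≡1 , ≤-antisym y≤2H 2H≤y
    where
    y<2H+P : y < 2 * H + P
    y<2H+P = subst (y <_) n≡2H+P y<n
    P≡1 : P ≡ 1
    P≡1 = ≤-antisym P≤1
      (+-cancelˡ-≤ (2 * H) 1 P (subst (_≤ 2 * H + P) (+-comm 1 (2 * H)) (≤-<-trans 2H≤y y<2H+P)))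
    y≤2H : y ≤ 2 * H
    y≤2H = ≤-pred (subst (y <_) (+-comm (2 * H) 1) (subst (λ p → y < 2 * H + p) P≡1 y<2H+P))

  rowBlock-split : ∀ {y} → y < n → RowSplit y (rowBlock y)
  rowBlock-split {y} y<n with y / 2 <? H
  ... | yes y/2<H = y/2<H , ≤-trans (m%n<n y 2) (2≤height (kind (y / 2))) , y≡
    where y≡ : y ≡ 2 * (y / 2) + y % 2
          y≡ = trans (m≡m%n+[m/n]*n y 2) (swap-halves (y / 2) (y % 2))
  ... | no  y/2≮H with top-row y<n 2H≤y
    where
    2H≤y : 2 * H ≤ y
    2H≤y = begin
      2 * H               ≤⟨ *-monoʳ-≤ 2 (≮⇒≥ y/2≮H) ⟩
      2 * (y / 2)         ≤⟨ m≤m+n (2 * (y / 2)) (y % 2) ⟩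
      2 * (y / 2) + y % 2 ≡⟨ swap-halves (y / 2) (y % 2) ⟨
      y % 2 + y / 2 * 2   ≡⟨ m≡m%n+[m/n]*n y 2 ⟨
      y                   ∎
      where open ≤-Reasoning
  ...   | P≡1 , y≡2H = H∸1<H , subst (λ κ → 2 < height κ) (sym (last-triple P≡1)) ≤-refl ,
                       trans y≡2H (sym (trans (two-below (H ∸ 1)) (cong (2 *_) H∸1+1)))

  rowBlock-inverse : ∀ m d → m < H → d < height (kind m) → rowBlock (2 * m + d) ≡ (m , d)
  rowBlock-inverse m d m<H d<h with d <? 2
  ... | yes d<2 = pair-row
    where
    halves : (2 * m + d) / 2 ≡ m × (2 * m + d) % 2 ≡ d
    halves = subst (λ y → y / 2 ≡ m × y % 2 ≡ d) (swap-halves m d) (quotRem-of d m d<2)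
    pair-row : rowBlock (2 * m + d) ≡ (m , d)
    pair-row with (2 * m + d) / 2 <? H
    ... | yes _ = cong₂ _,_ (proj₁ halves) (proj₂ halves)
    ... | no  ≮H = ⊥-elim (≮H (subst (_< H) (sym (proj₁ halves)) m<H))
  ... | no  d≮2 with kind m in eq
  ...   | pair = ⊥-elim (d≮2 d<h)
  ...   | triple with kind-triple m eq | ≤-antisym (≤-pred d<h) (≮⇒≥ d≮2)
  ...     | _ , m+1≡H | refl = triple-row
    where
    top : (2 * m + 2) / 2 ≡ H
    top = trans (cong (_/ 2) (trans (two-below m) (*-comm 2 (suc m))))
                (trans (proj₁ (quotRem-of {2} 0 (suc m) (s≤s z≤n))) m+1≡H)
    triple-row : rowBlock (2 * m + 2) ≡ (m , 2)
    triple-row with (2 * m + 2) / 2 <? H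
    ... | yes <H = ⊥-elim (<-irrefl top <H)
    ... | no  _  = cong (λ h → h ∸ 1 , 2) (sym m+1≡H)

  lionBlock : ℕ → ℕ × ℕ
  lionBlock a with a <? n
  ... | yes _ = rowBlock a
  ... | no  _ = a ∸ n , height (kind (a ∸ n))

  LionSlot : ℕ × ℕ → Set
  LionSlot (m , ρ) = m < H × ρ < lions (kind m)

  lionBlock-slot : ∀ {a} → a < n + H → LionSlot (lionBlock a)
  lionBlock-slot {a} a< with a <? n
  ... | yes a<n = let m<H , d<h , _ = rowBlock-split a<n in m<H , m≤n⇒m≤1+n d<h
  ... | no  a≮n = subst (a ∸ n <_) (m+n∸m≡n n H) (∸-monoˡ-< a< (≮⇒≥ a≮n)) , ≤-refl

  lionBlock-onto : ∀ m ρ → m < H → ρ < lions (kind m) → ∃ λ a → a < n + H × lionBlock a ≡ (m , ρ)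
  lionBlock-onto m ρ m<H ρ< with ρ <? height (kind m)
  ... | yes ρ<h = 2 * m + ρ , ≤-trans a<n (m≤m+n n H) , row-lion
    where
    a<n : 2 * m + ρ < n
    a<n = <-≤-trans (+-monoʳ-< (2 * m) ρ<h) (block-fits m m<H)
    row-lion : lionBlock (2 * m + ρ) ≡ (m , ρ)
    row-lion with 2 * m + ρ <? n
    ... | yes _  = rowBlock-inverse m ρ m<H ρ<h
    ... | no  ≮n = ⊥-elim (≮n a<n)
  ... | no  ρ≮h = n + m , +-monoʳ-< n m<H , extra-lion
    where
    extra-lion : lionBlock (n + m) ≡ (m , ρ)
    extra-lion with n + m <? n
    ... | yes <n = ⊥-elim (<⇒≱ <n (m≤m+n n m))
    ... | no  _  rewrite m+n∸m≡n n m = cong (m ,_) (≤-antisym (≮⇒≥ ρ≮h) (≤-pred ρ<))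

-- At ⟨ c , r , q ⟩ the columns up to c are cleared and the front is at row r of column c + 1,
-- where it spends four ticks q.
record Clock : Set where
  constructor ⟨_,_,_⟩
  field
    column row tick : ℕ

open Clock

module GridSweep (n″ : ℕ) where

  n′ n : ℕ
  n′ = suc n″
  n  = suc n′

  open Blocks n (s≤s (s≤s z≤n))

  next : Clock → Clock
  next ⟨ c , r , 0 ⟩ = ⟨ c , r , 1 ⟩
  next ⟨ c , r , 1 ⟩ = ⟨ c , r , 2 ⟩
  next ⟨ c , r , 2 ⟩ = ⟨ c , r , 3 ⟩
  next ⟨ c , r , suc (suc (suc _)) ⟩ with suc r <? n
  ... | yes _ = ⟨ c , suc r , 0 ⟩
  ... | no  _ = ⟨ suc c , 0 , 0 ⟩

  clock : ℕ → Clock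
  clock zero    = ⟨ 0 , 0 , 0 ⟩
  clock (suc τ) = next (clock τ)

  Consistent : ℕ → Clock → Set
  Consistent τ ⟨ c , r , q ⟩ = r < n × q < 4 × q + (c * n + r) * 4 ≡ τ

  clock-consistent : ∀ τ → Consistent τ (clock τ)
  clock-consistent zero    = s≤s z≤n , s≤s z≤n , refl
  clock-consistent (suc τ) = step (clock τ) (clock-consistent τ)
    where
    step : ∀ s → Consistent τ s → Consistent (suc τ) (next s)
    step ⟨ c , r , 0 ⟩ (r< , _ , refl) = r< , s≤s (s≤s z≤n) , refl
    step ⟨ c , r , 1 ⟩ (r< , _ , refl) = r< , s≤s (s≤s (s≤s z≤n)) , refl
    step ⟨ c , r , 2 ⟩ (r< , _ , refl) = r< , ≤-refl , refl
    step ⟨ c , r , suc (suc (suc (suc _))) ⟩ (_ , s≤s (s≤s (s≤s (s≤s ()))) , _)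
    step ⟨ c , r , 3 ⟩ (r< , _ , refl) with suc r <? n
    ... | yes r+1<n = r+1<n , s≤s z≤n , e (c * n) r
      where e : ∀ k r → (k + suc r) * 4 ≡ suc (3 + (k + r) * 4)
            e = solve-∀
    ... | no  r+1≮n = s≤s z≤n , s≤s z≤n , trans (cong (λ m → (m + c * n + 0) * 4) (sym r+1≡n)) (e (c * n) r)
      where r+1≡n : suc r ≡ n
            r+1≡n = ≤-antisym r< (≮⇒≥ r+1≮n)
            e : ∀ k r → (suc r + k + 0) * 4 ≡ suc (3 + (k + r) * 4)
            e = solve-∀

  front : Clock → ℕ
  front ⟨ c , r , q ⟩ = suc c * n + (r + ticked q)

  rear : Clock → ℕ
  rear ⟨ c , r , q ⟩ = suc c * n + (r + settled q)

  front≡rear-next : ∀ s → row s < n → tick s < 4 → front s ≡ rear (next s)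
  front≡rear-next ⟨ c , r , 0 ⟩ _ _ = refl
  front≡rear-next ⟨ c , r , 1 ⟩ _ _ = refl
  front≡rear-next ⟨ c , r , 2 ⟩ _ _ = refl
  front≡rear-next ⟨ c , r , suc (suc (suc (suc _))) ⟩ _ (s≤s (s≤s (s≤s (s≤s ()))))
  front≡rear-next ⟨ c , r , 3 ⟩ r< _ with suc r <? n
  ... | yes _ = cong (suc c * n +_) (trans (+-comm r 1) (sym (+-identityʳ (suc r))))
  ... | no  r+1≮n rewrite suc-injective (≤-antisym r< (≮⇒≥ r+1≮n)) = e c n′
    where e : ∀ c n′ → suc c * suc n′ + (n′ + 1) ≡ suc (suc c) * suc n′ + 0
          e = solve-∀

  band-position : ∀ s {x y} → row s < n → y < n → rear s ≤ x * n + y + n → x * n + y < front s →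
                  ∃ λ δ → δ < 2 × x ≡ column s + δ × InBand (row s) (tick s) (δ , y)
  band-position ⟨ c , r , q ⟩ {x} {y} r< y< behind ahead with staircase {n} {c} {x} y< reach lower ahead
    where
    reach : r + ticked q ≤ n
    reach = ≤-trans (+-monoʳ-≤ r (ticked≤1 q)) (subst (_≤ n) (+-comm 1 r) r<)
    lower : c * n + (r + settled q) ≤ x * n + y
    lower = +-cancelʳ-≤ n _ _ (subst (_≤ x * n + y + n) (e c n (r + settled q)) behind)
      where e : ∀ c n a → suc c * n + a ≡ c * n + a + n
            e = solve-∀
  ... | inj₁ (refl , a≤y) = 0 , s≤s z≤n , sym (+-identityʳ x) , inj₂ (refl , a≤y)
  ... | inj₂ (refl , y<b) = 1 , ≤-refl , +-comm 1 c , inj₁ (refl , y<b)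

  blockPhase : ℕ → ℕ → Phase
  blockPhase m r = phase (2 * m) (height (kind m)) r

  slotPlace : ℕ × ℕ → Clock → Point
  slotPlace (m , ρ) ⟨ c , r , q ⟩ = (c , 2 * m) ⊕ tab (kind m) (blockPhase m r) q ρ

  place : ℕ → Clock → Point
  place a = slotPlace (lionBlock a)

  cover : ∀ s {δ y} → row s < n → tick s < 4 → δ < 2 → y < n → InBand (row s) (tick s) (δ , y) →
          ∃ λ a → a < n + H × place a s ≡ (column s + δ , y)
  cover ⟨ c , r , q ⟩ {δ} {y} r< q< δ< y< band with rowBlock y | rowBlock-split y<
  ... | m , d | m<H , d<h , refl with tab-cover (kind m) (phase-valid (2 * m) r) q< δ< d<h
                                        (band-required (2 * m) r q δ d d<h band)
  ...   | ρ , ρ< , tab≡ with lionBlock-onto m ρ m<H ρ<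
  ...     | a , a< , lion≡ =
    a , a< , trans (cong (λ slot → slotPlace slot ⟨ c , r , q ⟩) lion≡) (cong ((c , 2 * m) ⊕_) tab≡)

  slot-step : ∀ {m ρ} → m < H → ρ < lions (kind m) → ∀ s → row s < n → tick s < 4 →
              slotPlace (m , ρ) s ~ slotPlace (m , ρ) (next s)
  slot-step {m} {ρ} m<H ρ< ⟨ c , r , q ⟩ r< q< = step q q<
    where
    κ = kind m
    1≤h : 1 ≤ height κ
    1≤h = ≤-trans (s≤s z≤n) (2≤height κ)
    move : ∀ {q} → q < 3 → slotPlace (m , ρ) ⟨ c , r , q ⟩ ~ slotPlace (m , ρ) ⟨ c , r , suc q ⟩
    move q<3 = ~-translate (c , 2 * m) (tab-move κ (phase-valid (2 * m) r) q<3 ρ<)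
    step : ∀ q → q < 4 → slotPlace (m , ρ) ⟨ c , r , q ⟩ ~ slotPlace (m , ρ) (next ⟨ c , r , q ⟩)
    step 0 _ = move (s≤s z≤n)
    step 1 _ = move (s≤s (s≤s z≤n))
    step 2 _ = move (s≤s (s≤s (s≤s z≤n)))
    step (suc (suc (suc (suc _)))) (s≤s (s≤s (s≤s (s≤s ()))))
    step 3 _ with suc r <? n
    ... | yes _ = ~-translate (c , 2 * m) (tab-succ κ (phase-succ (2 * m) r 1≤h) ρ<)
    ... | no  r+1≮n = subst (slotPlace (m , ρ) ⟨ c , r , 3 ⟩ ~_) (cong (_, 2 * m + proj₂ t) (+-suc c (proj₁ t)))
                        (~-translate (c , 2 * m) (tab-wrap κ final (phase-initial (2 * m) 1≤h) ρ<))
      where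
      t = tab κ (blockPhase m 0) 0 ρ
      final : Final (height κ) (blockPhase m r)
      final = phase-final (2 * m) r 1≤h (≤-trans (block-fits m m<H) (≮⇒≥ r+1≮n))

  slot-within : ∀ {m ρ} l″ → m < H → ρ < lions (kind m) → ∀ s → column s ≤ l″ → tick s < 4 →
                InBox n′ (suc l″) (slotPlace (m , ρ) s)
  slot-within {m} {ρ} l″ m<H ρ< ⟨ c , r , q ⟩ c≤ q< with tab-range (kind m) (phase-valid (2 * m) r) q< ρ<
  ... | dx≤1 , dy<h = subst (c + proj₁ t ≤_) (+-comm l″ 1) (+-mono-≤ c≤ dx≤1) ,
                      ≤-pred (<-≤-trans (+-monoʳ-< (2 * m) dy<h) (block-fits m m<H))
    where t = tab (kind m) (blockPhase m r) q ρ

  module Horizon (l″ : ℕ) where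

    last-cell : ℕ
    last-cell = l″ * n + n′

    duration : ℕ
    duration = 1 + last-cell * 4

    column-bounded : ∀ τ → τ ≤ duration → column (clock τ) ≤ l″
    column-bounded τ τ≤ with clock τ | clock-consistent τ
    ... | ⟨ c , r , q ⟩ | _ , _ , q+K*4≡τ = ≤-pred (*-cancelʳ-< n c (suc l″) (begin-strict
      c * n           ≤⟨ m≤m+n (c * n) r ⟩
      c * n + r       ≤⟨ K≤ ⟩
      l″ * n + n′     <⟨ +-monoʳ-< (l″ * n) ≤-refl ⟩
      l″ * n + n      ≡⟨ +-comm (l″ * n) n ⟩
      suc l″ * n      ∎))
      where
      open ≤-Reasoning
      K≤ : c * n + r ≤ last-cell
      K≤ with c * n + r ≤? last-cell
      ... | yes K≤ = K≤
      ... | no  K≰ = ⊥-elim (<⇒≱ (begin-strict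
        τ                   ≤⟨ τ≤ ⟩
        1 + last-cell * 4   <⟨ +-monoˡ-≤ (last-cell * 4) (s≤s (s≤s z≤n)) ⟩
        suc last-cell * 4   ≤⟨ *-monoˡ-≤ 4 (≰⇒> K≰) ⟩
        (c * n + r) * 4     ≤⟨ m≤n+m _ q ⟩
        q + (c * n + r) * 4 ≡⟨ q+K*4≡τ ⟩
        τ                   ∎) ≤-refl)

    front-at-end : front (clock duration) ≡ suc (suc l″) * n
    front-at-end with clock duration | clock-consistent duration
    ... | ⟨ c , r , q ⟩ | _ , q< , q+K*4≡τ
      with quotRem-unique {4} (c * n + r) last-cell q< (s≤s (s≤s z≤n)) q+K*4≡τ
    ...   | K≡ , refl = begin
      suc c * n + (r + 1)   ≡⟨ e c r n ⟩
      n + (c * n + r) + 1   ≡⟨ cong (λ K → n + K + 1) K≡ ⟩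
      n + last-cell + 1     ≡⟨ f l″ n′ ⟩
      suc (suc l″) * n      ∎
      where
      open ≡-Reasoning
      e : ∀ c r n → suc c * n + (r + 1) ≡ n + (c * n + r) + 1
      e = solve-∀
      f : ∀ l″ n′ → suc n′ + (l″ * suc n′ + n′) + 1 ≡ suc (suc l″) * suc n′
      f = solve-∀

  module Grid (l″ : ℕ) (p : Placement ((3 * n) / 2) n (suc (suc l″))) where

    open Horizon l″

    l′ l k : ℕ
    l′ = suc l″
    l  = suc l′
    k  = (3 * n) / 2

    slot : (a : Fin k) → LionSlot (lionBlock (toℕ a))
    slot a = lionBlock-slot (subst (toℕ a <_) lion-count (toℕ<n a))

    formation : Fin k → ℕ → Point
    formation a τ = place (toℕ a) (clock τ)

    formation-walk : ∀ a → Walk duration (formation a)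
    formation-walk a τ _ =
      let r< , q< , _ = clock-consistent τ in slot-step (proj₁ (slot a)) (proj₂ (slot a)) (clock τ) r< q<

    formation-within : ∀ a τ → τ ≤ duration → InBox n′ l′ (formation a τ)
    formation-within a τ τ≤ =
      slot-within l″ (proj₁ (slot a)) (proj₂ (slot a)) (clock τ)
        (column-bounded τ τ≤) (proj₁ (proj₂ (clock-consistent τ)))

    M : ℕ
    M = l′ + n′ + 3

    roomy : ∀ {v} → InBox n′ l′ v → size v + 3 ≤ M
    roomy (x≤ , y≤) = +-monoˡ-≤ 3 (+-mono-≤ x≤ y≤)

    start target : Fin k → Point
    start a  = coords (p a)
    target a = formation a 0

    start-roomy : ∀ a → size (start a) + 3 ≤ M
    start-roomy a = roomy (coords-inBox (p a))

    target-roomy : ∀ a → size (target a) + 3 ≤ M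
    target-roomy a = roomy (formation-within a 0 z≤n)

    journey : Fin k → ℕ → Point
    journey a = transfer M (start a) (target a)

    module Journey (a : Fin k) = Transfer M (start a) (target a) (start-roomy a) (target-roomy a)

    trajectory : Fin k → ℕ → Point
    trajectory a = journey a ▹⟨ M + M ⟩ formation a

    σ : Schedule k n l
    σ t a = vertex n′ l′ (trajectory a t)

    σ-start : ∀ a → σ 0 a ≡ p a
    σ-start a = trans (cong (vertex n′ l′) (trans (▹-start (journey a) (M + M) (formation a)) (Journey.begins a)))
                      (vertex-coords n′ l′ (p a))

    σ-formation : ∀ a τ → σ (M + M + τ) a ≡ vertex n′ l′ (formation a τ)
    σ-formation a τ = cong (vertex n′ l′) (▹-shift (journey a) (M + M) (formation a) (Journey.ends a) τ)

    caffeinated : CaffeinatedUpTo σ (M + M + duration)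
    caffeinated t t< a = ~⇒Adj n′ l′ (within t (<⇒≤ t<)) (within (suc t) t<) (walk t t<)
      where
      walk : Walk (M + M + duration) (trajectory a)
      walk = ▹-walk (M + M) (Journey.ends a) (Journey.walk a) (formation-walk a)
      within : ∀ t → t ≤ M + M + duration → InBox n′ l′ (trajectory a t)
      within = ▹-within (InBox n′ l′) (journey a) (M + M) (formation a) duration
                 (Journey.within a (s≤s z≤n) (s≤s z≤n) (coords-inBox (p a)) (formation-within a 0 z≤n))
                 (formation-within a)

    occupied : ∀ τ v → rear (clock τ) ≤ rankᵛ v + n → rankᵛ v < front (clock τ) →
               Occupied (σ (M + M + τ)) v
    occupied τ v behind ahead with clock-consistent τ
    ... | r< , q< , _ with band-position (clock τ) r< (toℕ<n (proj₂ v)) behind ahead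
    ...   | δ , δ< , x≡ , band with cover (clock τ) r< q< δ< (toℕ<n (proj₂ v)) band
    ...     | a , a< , place≡ =
      lion , trans (σ-formation lion τ) (trans (cong (vertex n′ l′) placed) (vertex-coords n′ l′ v))
      where
      a<k : a < k
      a<k = subst (a <_) (sym lion-count) a<
      lion : Fin k
      lion = fromℕ< a<k
      placed : formation lion τ ≡ coords v
      placed = trans (cong (λ i → place i (clock τ)) (toℕ-fromℕ< a<k)) (trans place≡ (cong (_, _) (sym x≡)))

    start-occupied : ∀ v → rankᵛ v < front (clock 0) → Occupied (σ (M + M)) v
    start-occupied v ahead = subst (λ t → Occupied (σ t) v) (+-identityʳ (M + M))
      (occupied 0 v (≤-trans (≤-reflexive rear₀≡n) (m≤n+m n (rankᵛ v))) ahead)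
      where
      rear₀≡n : rear (clock 0) ≡ n
      rear₀≡n = trans (+-identityʳ (n + 0)) (+-identityʳ n)

    band-occupied : ∀ τ v → rankᵛ v < front (clock (suc τ)) → front (clock τ) ≤ rankᵛ v + n →
                    Occupied (σ (suc (M + M + τ))) v
    band-occupied τ v ahead behind =
      let r< , q< , _ = clock-consistent τ in
      subst (λ t → Occupied (σ t) v) (+-suc (M + M) τ)
        (occupied (suc τ) v (subst (_≤ rankᵛ v + n) (front≡rear-next (clock τ) r< q<) behind) ahead)

    open BandSweep σ rankᵛ n Adj-rank (M + M) (λ τ → front (clock τ)) start-occupied band-occupied

    clearing : ClearingSchedule p
    clearing = σ , σ-start , M + M + duration , caffeinated ,
      λ v → Equivalence.to T-≡ (sweep-band duration v (subst (rankᵛ v <_) (sym front-at-end) (rank-bounded v)))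

some-lion : ∀ {n} → 1 ≤ n → Fin ((3 * n) / 2)
some-lion 1≤n = fromℕ< (m≥n⇒m/n>0 (≤-trans (s≤s (s≤s z≤n)) (*-monoʳ-≤ 3 1≤n)))

mainTheorem3 : (n l : ℕ) → 1 ≤ n → 1 ≤ l →
    (p : Placement ((3 * n) / 2) n l) →
    Σ (Schedule ((3 * n) / 2) n l) (λ σ →
      (∀ a → σ 0 a ≡ p a) × ∃ (λ t → CaffeinatedUpTo σ t × AllCleared σ t))
mainTheorem3 (suc zero)     (suc l′)       1≤n _ p = row-clearing l′ (some-lion 1≤n) p
mainTheorem3 (suc (suc n″)) (suc zero)     1≤n _ p = column-clearing (suc n″) (some-lion 1≤n) p
mainTheorem3 (suc (suc n″)) (suc (suc l″)) _   _ p = GridSweep.Grid.clearing n″ l″ p
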